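{- Let $k\ge1$. For $1\le s\le k$ and $n,j\ge1$, let $BF'_{k,k}(n,j)$ be the number of overpartitions $\lambda$ of $n$ in $\mathcal{BF}_k$ such that $\ell(\lambda)\equiv0\pmod k$, $\ell_o(\lambda)=j$ and the largest part of $\lambda$ is $\overline j$; let $BF''_{k,s}(n,j-1)$ be the number of overpartitions $\lambda$ of $n$ in $\mathcal{BF}_k$ such that $\ell(\lambda)\equiv s\pmod k$, $\ell_o(\lambda)=j-1$ and the largest part of $\lambda$ is $j$; and let $D_{k,s}(n,j)$ be the number of partitions of $n$ into $j$ distinct parts, each congruent to $s$ modulo $k$. Then \[ BF'_{k,k}(n,j)=D_{k,k}(n,j)\quad\text{and}\quad BF''_{k,s}(n,j-1)=D_{k,s}(n,j). \]
   Context: Overpartitions here are non-increasing sequences of positive integers in which the first occurrence of each distinct part value may be overlined (among equal sizes the overlined part comes first); a part $t$ or $\overline t$ has size $t$, written $|\cdot|=t$; an overpartition of $n$ has part sizes summing to $n$; $\ell(\lambda)$ is the number of parts and $\ell_o(\lambda)$ the number of overlined parts. An $F_k$-overpartition is such an overpartition $\pi=(\pi_1,\ldots,\pi_\ell)$ with the property that whenever $\pi_i$ is overlined, $\ell-i\equiv-1\pmod k$. For $m\ge1$, $\mathcal{BF}_k(m)$ is the set of $F_k$-overpartitions $\lambda=(\lambda_1,\ldots,\lambda_m)$ with exactly $m$ parts such that (i) if $k=1$ then $\lambda_m=\overline1$ or $1$, and if $k\ge2$ then $\lambda_m=1$; (ii) for $1\le i<m$, $|\lambda_i|\le|\lambda_{i+1}|+1$,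 with strict inequality if $\lambda_{i+1}$ is non-overlined. $\mathcal{BF}_k=\bigcup_{m\ge1}\mathcal{BF}_k(m)$. -}

module Defs where

open import Data.Nat using (ℕ; zero; suc; _+_; _∸_; _≡ᵇ_; _≤ᵇ_; _<ᵇ_; _%_; NonZero)
open import Data.Bool using (Bool; true; false; _∧_; not; if_then_else_; T)
open import Data.List using (List; []; _∷_; length)
open import Data.Product using (_×_; _,_; proj₁; proj₂; Σ)

-- A part of an overpartition: (size t , overlined?).  (t , true) is \overline t.
Part : Set
Part = ℕ × Bool

size : Part → ℕ
size = proj₁

ovl : Part → Bool
ovl = proj₂

OverPtn : Set
OverPtn = List Part

weight : OverPtn → ℕ
weight [] = 0
weight (p ∷ r) = size p + weight r

numOvl : OverPtn → ℕ
numOvl [] = 0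
numOvl (p ∷ r) = (if ovl p then 1 else 0) + numOvl r

allPos : OverPtn → Bool
allPos [] = true
allPos (p ∷ r) = (1 ≤ᵇ size p) ∧ allPos r

-- sizes are non-increasing; among consecutive equal sizes the later one is
-- non-overlined (so only the first occurrence of a value may be overlined,
-- and the overlined copy comes first)
wellOrdered : OverPtn → Bool
wellOrdered [] = true
wellOrdered (p ∷ []) = true
wellOrdered (p ∷ q ∷ r) =
  (size q ≤ᵇ size p)
  ∧ (if size q ≡ᵇ size p then not (ovl q) else true)
  ∧ wellOrdered (q ∷ r)

isOverPtn : OverPtn → Bool
isOverPtn π = allPos π ∧ wellOrdered π

-- F_k condition: if π_i is overlined then ℓ - i ≡ -1 (mod k), i.e.
-- k divides ℓ - i + 1, the number of parts π_i, …, π_ℓ (the suffix from π_i).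
fkCond : (k : ℕ) → .{{NonZero k}} → OverPtn → Bool
fkCond k [] = true
fkCond k (p ∷ r) =
  (if ovl p then (suc (length r) % k ≡ᵇ 0) else true) ∧ fkCond k r

isFk : (k : ℕ) → .{{NonZero k}} → OverPtn → Bool
isFk k π = isOverPtn π ∧ fkCond k π

lastCond : ℕ → OverPtn → Bool
lastCond k [] = false
lastCond k (p ∷ []) =
  if k ≡ᵇ 1 then size p ≡ᵇ 1 else ((size p ≡ᵇ 1) ∧ not (ovl p))
lastCond k (p ∷ q ∷ r) = lastCond k (q ∷ r)

gapCond : OverPtn → Bool
gapCond [] = true
gapCond (p ∷ []) = true
gapCond (p ∷ q ∷ r) =
  (if ovl q then size p ≤ᵇ suc (size q) else size p <ᵇ suc (size q))
  ∧ gapCond (q ∷ r)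

-- l ∈ BF_k  (= ⋃_{m ≥ 1} BF_k(m), with m = ℓ(l))
inBF : (k : ℕ) → .{{NonZero k}} → OverPtn → Bool
inBF k l = (1 ≤ᵇ length l) ∧ isFk k l ∧ lastCond k l ∧ gapCond l

largestIs : Part → OverPtn → Bool
largestIs p [] = false
largestIs p (q ∷ r) =
  (size q ≡ᵇ size p) ∧ (if ovl p then ovl q else not (ovl q))

isBF′ : (k : ℕ) → .{{NonZero k}} → ℕ → ℕ → OverPtn → Bool
isBF′ k n j l =
  inBF k l ∧ (weight l ≡ᵇ n) ∧ (length l % k ≡ᵇ 0)
  ∧ (numOvl l ≡ᵇ j) ∧ largestIs (j , true) l

BF′ : (k : ℕ) → .{{NonZero k}} → ℕ → ℕ → Set
BF′ k n j = Σ OverPtn (λ lam → T (isBF′ k n j lam))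

isBF″ : (k : ℕ) → .{{NonZero k}} → ℕ → ℕ → ℕ → OverPtn → Bool
isBF″ k s n j l =
  inBF k l ∧ (weight l ≡ᵇ n) ∧ (length l % k ≡ᵇ s % k)
  ∧ (numOvl l ≡ᵇ j ∸ 1) ∧ largestIs (j , false) l

BF″ : (k : ℕ) → .{{NonZero k}} → ℕ → ℕ → ℕ → Set
BF″ k s n j = Σ OverPtn (λ lam → T (isBF″ k s n j lam))

sumL : List ℕ → ℕ
sumL [] = 0
sumL (x ∷ r) = x + sumL r

strictDec : List ℕ → Bool
strictDec [] = true
strictDec (x ∷ []) = true
strictDec (x ∷ y ∷ r) = (y <ᵇ x) ∧ strictDec (y ∷ r)

allPosL : List ℕ → Bool
allPosL [] = true
allPosL (x ∷ r) = (1 ≤ᵇ x) ∧ allPosL r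

allCong : (k : ℕ) → .{{NonZero k}} → ℕ → List ℕ → Bool
allCong k s [] = true
allCong k s (x ∷ r) = (x % k ≡ᵇ s % k) ∧ allCong k s r

isD : (k : ℕ) → .{{NonZero k}} → ℕ → ℕ → ℕ → List ℕ → Bool
isD k s n j μ =
  allPosL μ ∧ strictDec μ ∧ (sumL μ ≡ᵇ n) ∧ (length μ ≡ᵇ j) ∧ allCong k s μ

D : (k : ℕ) → .{{NonZero k}} → ℕ → ℕ → ℕ → Set
D k s n j = Σ (List ℕ) (λ mu → T (isD k s n j mu))

-- Read from its largest part j downwards, an overpartition λ on the left is a
-- staircase: m_j copies of j, then m_{j-1} copies of j-1, …, then m_1 copies of 1,
-- where the gap condition forces the first copy of every value below j to be
-- overlined.  The F_k condition then says that k divides m_1, …, m_{j-1} (and m_j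
-- too when j is overlined), so ℓ(λ) ≡ s (mod k) amounts to m_j ≡ s (mod k).  The
-- conjugate μ_u = m_u + ⋯ + m_j (1 ≤ u ≤ j) is a partition of the same n into j
-- distinct parts, all ≡ m_j (mod k), and its gaps μ_u − μ_{u+1} = m_u, μ_j = m_j
-- give the multiplicities back.  So both sides are parametrised by the same gap
-- data, and the bijection passes through it.

module Submission where

open import Defs
open import Data.Nat using (ℕ; _≤_; NonZero)
open import Data.Product using (_×_)
open import Function.Bundles using (_↔_)

open import Data.Bool using (Bool; true; false; _∧_; not; if_then_else_; T)
open import Data.Bool.Properties using (T-∧; T-irrelevant)
open import Data.Empty using (⊥-elim)
open import Data.List using (List; []; _∷_; length; replicate; reverse; _++_; _∷ʳ_)
open import Data.List.NonEmpty using (List⁺)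
open import Data.List.Properties
  using (∷-injective; ∷-injectiveˡ; ∷-injectiveʳ; length-++; length-replicate; length-reverse;
         reverse-involutive; reverse-injective; unfold-reverse; ++-identityʳ)
open import Data.List.Relation.Unary.All as All using (All; []; _∷_)
open import Data.List.Relation.Unary.Linked using (Linked; []; [-]; _∷_)
open import Data.List.Relation.Binary.Permutation.Propositional using (↭-sym)
open import Data.List.Relation.Binary.Permutation.Propositional.Properties using (All-resp-↭; ↭-reverse)
open import Data.List.Scans.Base using (scanr; scanr⁺)
open import Data.Nat using (suc; zero; _+_; _*_; _∸_; _>_; _%_; _/_; _≡ᵇ_; _≤ᵇ_; z≤n; s≤s)
open import Data.Nat.ListAction using (sum)
open import Data.Nat.ListAction.Properties using (sum-↭)
open import Data.Nat.Properties
open import Data.Nat.DivMod using (m≡m%n+[m/n]*n; %-remove-+ˡ; n%n≡0)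
open import Data.Nat.Divisibility using (_∣_; divides; ∣m∣n⇒∣m+n; ∣m+n∣m⇒∣n; ∣1⇒≡1; n∣m⇒m%n≡0; m%n≡0⇒n∣m)
open import Data.Nat.Tactic.RingSolver using (solve-∀)
open import Data.Product using (Σ; ∃₂; _,_; proj₁; proj₂; uncurry)
open import Function.Base using (_∘_)
open import Function.Bundles using (_⇔_; mk⇔; mk↔ₛ′; Equivalence)
open import Relation.Binary.PropositionalEquality

open Equivalence using (to; from)

≡-subset : ∀ {A : Set} {P : A → Bool} {a a′ : A} {p : T (P a)} {p′ : T (P a′)} →
           a ≡ a′ → _≡_ {A = Σ A (T ∘ P)} (a , p) (a′ , p′)
≡-subset refl = cong (_ ,_) (T-irrelevant _ _)

T-if-else-true : ∀ b {x} → T (if b then x else true) ⇔ (T b → T x)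
T-if-else-true true  = mk⇔ (λ t _ → t) (λ f → f _)
T-if-else-true false = mk⇔ (λ _ ()) (λ _ → _)

T-if-self : ∀ b → T (if b then b else not b)
T-if-self true  = _
T-if-self false = _

T-if-self⁻ : ∀ b {b′} → T (if b then b′ else not b′) → b′ ≡ b
T-if-self⁻ true  {true}  _ = refl
T-if-self⁻ false {false} _ = refl

-- Bijections through a common parametrisation

record Parametrisation {A X : Set} (Good : X → Set) (P : A → Bool) : Set where
  field
    encode    : X → A
    sound     : ∀ {x} → Good x → T (P (encode x))
    onto      : ∀ {a} → T (P a) → Σ X λ x → Good x × encode x ≡ a
    injective : ∀ {x y} → Good x → Good y → encode x ≡ encode y → x ≡ y

module _ {X : Set} {Good : X → Set} where
  open Parametrisation

  reparametrise : {A B : Set} {P : A → Bool} {Q : B → Bool} →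
                  Parametrisation Good P → Parametrisation Good Q → Σ A (T ∘ P) → Σ B (T ∘ Q)
  reparametrise πP πQ (_ , p) = let (x , good , _) = onto πP p in encode πQ x , sound πQ good

  reparametrise-inverse : {A B : Set} {P : A → Bool} {Q : B → Bool}
                          (πP : Parametrisation Good P) (πQ : Parametrisation Good Q) →
                          ∀ q → reparametrise πP πQ (reparametrise πQ πP q) ≡ q
  reparametrise-inverse πP πQ (_ , q) =
    let (y , good-y , encode-y) = onto πQ q
        (x , good-x , encode-x) = onto πP (sound πP good-y)
    in  ≡-subset (trans (cong (encode πQ) (injective πP good-x good-y encode-x)) encode-y)

  parametrisations⇒↔ : {A B : Set} {P : A → Bool} {Q : B → Bool} →
                       Parametrisation Good P → Parametrisation Good Q → Σ A (T ∘ P) ↔ Σ B (T ∘ Q)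
  parametrisations⇒↔ πP πQ =
    mk↔ₛ′ (reparametrise πP πQ) (reparametrise πQ πP)
          (reparametrise-inverse πP πQ) (reparametrise-inverse πQ πP)

-- Strictly decreasing lists as scans of their gaps

[m+n]%d≡n%d⇒d∣m : ∀ m n {d} .{{_ : NonZero d}} → (m + n) % d ≡ n % d → d ∣ m
[m+n]%d≡n%d⇒d∣m m n {d} eq = divides ((m + n) / d ∸ n / d) (begin
  m
    ≡⟨ m+n∸n≡m m n ⟨
  m + n ∸ n
    ≡⟨ cong₂ _∸_ (m≡m%n+[m/n]*n (m + n) d) (m≡m%n+[m/n]*n n d) ⟩
  ((m + n) % d + (m + n) / d * d) ∸ (n % d + n / d * d)
    ≡⟨ cong (λ r → (r + (m + n) / d * d) ∸ (n % d + n / d * d)) eq ⟩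
  (n % d + (m + n) / d * d) ∸ (n % d + n / d * d)
    ≡⟨ [m+n]∸[m+o]≡n∸o (n % d) _ _ ⟩
  (m + n) / d * d ∸ n / d * d
    ≡⟨ *-distribʳ-∸ d ((m + n) / d) (n / d) ⟨
  ((m + n) / d ∸ n / d) * d ∎)
  where open ≡-Reasoning

All-reverse : ∀ {A : Set} {P : A → Set} {xs} → All P xs → All P (reverse xs)
All-reverse {xs = xs} = All-resp-↭ (↭-sym (↭-reverse xs))

∣-sum : ∀ {d ns} → All (d ∣_) ns → d ∣ sum ns
∣-sum []       = divides 0 refl
∣-sum (d ∷ ds) = ∣m∣n⇒∣m+n d (∣-sum ds)

length-scanr : ∀ {A B : Set} (f : A → B → B) e xs → length (scanr f e xs) ≡ suc (length xs)
length-scanr f e []       = refl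
length-scanr f e (x ∷ xs) = cong suc (length-scanr f e xs)

All-scanr-last : ∀ {A B : Set} {P : B → Set} (f : A → B → B) e xs → All P (scanr f e xs) → P e
All-scanr-last f e []       (pe ∷ []) = pe
All-scanr-last f e (x ∷ xs) (_ ∷ ps)  = All-scanr-last f e xs ps

head-scanr⁺-+ : ∀ b C → List⁺.head (scanr⁺ _+_ b C) ≡ sum C + b
head-scanr⁺-+ b []      = refl
head-scanr⁺-+ b (c ∷ C) = trans (cong (c +_) (head-scanr⁺-+ b C)) (sym (+-assoc c (sum C) b))

scanr-+-≥ : ∀ b C → All (b ≤_) (scanr _+_ b C)
scanr-+-≥ b []      = ≤-refl ∷ []
scanr-+-≥ b (c ∷ C) = let rest = scanr-+-≥ b C in ≤-trans (All.head rest) (m≤n+m _ c) ∷ rest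

scanr-+-injective : ∀ {b b′} C C′ → scanr _+_ b C ≡ scanr _+_ b′ C′ → C ≡ C′ × b ≡ b′
scanr-+-injective []      []        eq = refl , ∷-injectiveˡ eq
scanr-+-injective (c ∷ C) (c′ ∷ C′) eq with ∷-injective eq
... | heads , tails with scanr-+-injective C C′ tails
... | refl , refl = cong (_∷ C) (+-cancelʳ-≡ _ c c′ heads) , refl

Linked-scanr-+⁺ : ∀ {b C} → All (1 ≤_) C → Linked _>_ (scanr _+_ b C)
Linked-scanr-+⁺ []         = [-]
Linked-scanr-+⁺ (1≤c ∷ ps) = m<n+m _ 1≤c ∷ Linked-scanr-+⁺ ps

Linked-scanr-+⁻ : ∀ {b} C → Linked _>_ (scanr _+_ b C) → All (1 ≤_) C
Linked-scanr-+⁻ []      _             = []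
Linked-scanr-+⁻ (c ∷ C) (h<c+h ∷ dec) = +-cancelʳ-< _ 0 c h<c+h ∷ Linked-scanr-+⁻ C dec

Linked⇒∃scanr-+ : ∀ x r → Linked _>_ (x ∷ r) → ∃₂ λ C b → scanr _+_ b C ≡ x ∷ r
Linked⇒∃scanr-+ x []      _           = [] , x , refl
Linked⇒∃scanr-+ x (y ∷ r) (y<x ∷ dec) =
  let (C , b , eq) = Linked⇒∃scanr-+ y r dec
      top : x ∸ y + List⁺.head (scanr⁺ _+_ b C) ≡ x
      top = trans (cong (x ∸ y +_) (∷-injectiveˡ eq)) (m∸n+n≡m (<⇒≤ y<x))
  in  x ∸ y ∷ C , b , cong₂ _∷_ top eq

module _ {d : ℕ} .{{_ : NonZero d}} where

  scanr-+-mod⁺ : ∀ {s b C} → All (d ∣_) C → b % d ≡ s % d → All (λ x → x % d ≡ s % d) (scanr _+_ b C)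
  scanr-+-mod⁺ []         b≡s = b≡s ∷ []
  scanr-+-mod⁺ (d∣c ∷ ds) b≡s =
    let rest = scanr-+-mod⁺ ds b≡s in trans (%-remove-+ˡ _ d∣c) (All.head rest) ∷ rest

  scanr-+-mod⁻ : ∀ {s b} C → All (λ x → x % d ≡ s % d) (scanr _+_ b C) → All (d ∣_) C
  scanr-+-mod⁻ []      _                = []
  scanr-+-mod⁻ (c ∷ C) (c+h≡s ∷ rest) =
    [m+n]%d≡n%d⇒d∣m c _ (trans c+h≡s (sym (All.head rest))) ∷ scanr-+-mod⁻ C rest

allPosL⇔All : ∀ xs → T (allPosL xs) ⇔ All (1 ≤_) xs
allPosL⇔All xs = mk⇔ (elim xs) intro
  where
  elim : ∀ xs → T (allPosL xs) → All (1 ≤_) xs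
  elim []       _   = []
  elim (x ∷ xs) pos = let (1≤x , pos′) = to T-∧ pos in ≤ᵇ⇒≤ 1 x 1≤x ∷ elim xs pos′
  intro : ∀ {xs} → All (1 ≤_) xs → T (allPosL xs)
  intro []           = _
  intro (1≤x ∷ 1≤xs) = from T-∧ (≤⇒≤ᵇ 1≤x , intro 1≤xs)

strictDec⇔Linked : ∀ xs → T (strictDec xs) ⇔ Linked _>_ xs
strictDec⇔Linked xs = mk⇔ (elim xs) intro
  where
  elim : ∀ xs → T (strictDec xs) → Linked _>_ xs
  elim []           _   = []
  elim (x ∷ [])     _   = [-]
  elim (x ∷ y ∷ xs) dec = let (y<x , dec′) = to T-∧ dec in <ᵇ⇒< y x y<x ∷ elim (y ∷ xs) dec′
  intro : ∀ {xs} → Linked _>_ xs → T (strictDec xs)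
  intro []          = _
  intro [-]         = _
  intro (y<x ∷ dec) = from T-∧ (<⇒<ᵇ y<x , intro dec)

allCong⇔All : ∀ k .{{_ : NonZero k}} s xs → T (allCong k s xs) ⇔ All (λ x → x % k ≡ s % k) xs
allCong⇔All k s xs = mk⇔ (elim xs) intro
  where
  elim : ∀ xs → T (allCong k s xs) → All (λ x → x % k ≡ s % k) xs
  elim []       _  = []
  elim (x ∷ xs) ok = let (x≡s , ok′) = to T-∧ ok in ≡ᵇ⇒≡ _ _ x≡s ∷ elim xs ok′
  intro : ∀ {xs} → All (λ x → x % k ≡ s % k) xs → T (allCong k s xs)
  intro []           = _
  intro (x≡s ∷ x≡ss) = from T-∧ (≡⇒≡ᵇ _ _ x≡s , intro x≡ss)

-- Staircase overpartitions

block : Bool → ℕ → ℕ → OverPtn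
block o v zero    = []
block o v (suc c) = (v , o) ∷ replicate c (v , false)

-- staircase o (m_j ∷ ⋯ ∷ m_1 ∷ []) has m_v copies of v for v = j, …, 1; the first
-- copy of each value is overlined, except that of j when o is false.
staircase : Bool → List ℕ → OverPtn
staircase o []      = []
staircase o (b ∷ B) = block o (suc (length B)) b ++ staircase true B

staircaseWeight : List ℕ → ℕ
staircaseWeight []      = 0
staircaseWeight (b ∷ B) = b * suc (length B) + staircaseWeight B

length-staircase : ∀ o M → length (staircase o M) ≡ sum M
length-staircase o []      = refl
length-staircase o (b ∷ B) =
  trans (length-++ (block o _ b)) (cong₂ _+_ (length-block b) (length-staircase true B))
  where
  length-block : ∀ {v} b → length (block o v b) ≡ b
  length-block zero    = refl
  length-block (suc c) = cong suc (length-replicate c)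

weight-++ : ∀ xs ys → weight (xs ++ ys) ≡ weight xs + weight ys
weight-++ []       ys = refl
weight-++ (x ∷ xs) ys = trans (cong (size x +_) (weight-++ xs ys)) (sym (+-assoc (size x) _ _))

weight-staircase : ∀ o M → weight (staircase o M) ≡ staircaseWeight M
weight-staircase o []      = refl
weight-staircase o (b ∷ B) =
  trans (weight-++ (block o _ b) _) (cong₂ _+_ (weight-block b) (weight-staircase true B))
  where
  v = suc (length B)
  weight-replicate : ∀ c → weight (replicate c (v , false)) ≡ c * v
  weight-replicate zero    = refl
  weight-replicate (suc c) = cong (v +_) (weight-replicate c)
  weight-block : ∀ b → weight (block o v b) ≡ b * v
  weight-block zero    = refl
  weight-block (suc c) = cong (v +_) (weight-replicate c)

staircaseWeight-∷ʳ : ∀ M c → staircaseWeight (M ∷ʳ c) ≡ staircaseWeight M + sum M + c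
staircaseWeight-∷ʳ []      c = trans (+-identityʳ (c * 1)) (*-identityʳ c)
staircaseWeight-∷ʳ (m ∷ M) c = begin
  m * suc (length (M ∷ʳ c)) + staircaseWeight (M ∷ʳ c)
    ≡⟨ cong₂ (λ L W → m * suc L + W) (length-++ M) (staircaseWeight-∷ʳ M c) ⟩
  m * suc (length M + 1) + (staircaseWeight M + sum M + c)
    ≡⟨ rearrange m (length M) (staircaseWeight M) (sum M) c ⟩
  m * suc (length M) + staircaseWeight M + (m + sum M) + c ∎
  where
  open ≡-Reasoning
  rearrange : ∀ m L W S c → m * suc (L + 1) + (W + S + c) ≡ m * suc L + W + (m + S) + c
  rearrange = solve-∀

staircaseWeight-reverse : ∀ b C → staircaseWeight (b ∷ reverse C) ≡ sumL (scanr _+_ b C)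
staircaseWeight-reverse b []      =
  trans (+-identityʳ (b * 1)) (trans (*-identityʳ b) (sym (+-identityʳ b)))
staircaseWeight-reverse b (c ∷ C) = begin
  staircaseWeight (b ∷ reverse (c ∷ C))
    ≡⟨ cong (staircaseWeight ∘ (b ∷_)) (unfold-reverse c C) ⟩
  staircaseWeight ((b ∷ reverse C) ∷ʳ c)
    ≡⟨ staircaseWeight-∷ʳ (b ∷ reverse C) c ⟩
  staircaseWeight (b ∷ reverse C) + (b + sum (reverse C)) + c
    ≡⟨ cong₂ (λ W S → W + (b + S) + c) (staircaseWeight-reverse b C) (sum-↭ (↭-reverse C)) ⟩
  sumL (scanr _+_ b C) + (b + sum C) + c
    ≡⟨ rearrange (sumL (scanr _+_ b C)) b (sum C) c ⟩
  c + (sum C + b) + sumL (scanr _+_ b C)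
    ≡⟨ cong (λ h → c + h + sumL (scanr _+_ b C)) (head-scanr⁺-+ b C) ⟨
  sumL (scanr _+_ b (c ∷ C)) ∎
  where
  open ≡-Reasoning
  rearrange : ∀ W b S c → W + (b + S) + c ≡ c + (S + b) + W
  rearrange = solve-∀

weight-staircase-reverse : ∀ o b C → weight (staircase o (b ∷ reverse C)) ≡ sumL (scanr _+_ b C)
weight-staircase-reverse o b C = trans (weight-staircase o (b ∷ reverse C)) (staircaseWeight-reverse b C)

numOvl-replicate-++ : ∀ c v xs → numOvl (replicate c (v , false) ++ xs) ≡ numOvl xs
numOvl-replicate-++ zero    v xs = refl
numOvl-replicate-++ (suc c) v xs = numOvl-replicate-++ c v xs

numOvl-staircase : ∀ o b B → All (1 ≤_) (b ∷ B) →
                   numOvl (staircase o (b ∷ B)) ≡ (if o then 1 else 0) + length B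
numOvl-staircase o zero    B       (() ∷ _)
numOvl-staircase o (suc c) []      _        = cong (_ +_) (numOvl-replicate-++ c 1 [])
numOvl-staircase o (suc c) (b ∷ B) (_ ∷ ps) =
  cong (_ +_) (trans (numOvl-replicate-++ c _ _) (numOvl-staircase true b B ps))

module _ (P : OverPtn → Bool)
         (single  : ∀ o → T (P ((1 , o) ∷ [])))
         (repeat  : ∀ v o r → T (P ((suc v , false) ∷ r)) → T (P ((suc v , o) ∷ (suc v , false) ∷ r)))
         (descend : ∀ v o r → T (P ((suc v , true) ∷ r)) → T (P ((suc (suc v) , o) ∷ (suc v , true) ∷ r)))
  where

  staircase-chain : ∀ o b B → All (1 ≤_) (b ∷ B) → T (P (staircase o (b ∷ B)))
  below : ∀ o B → All (1 ≤_) B → T (P ((suc (length B) , o) ∷ staircase true B))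

  staircase-chain o zero    B (() ∷ _)
  staircase-chain o (suc c) B (_ ∷ ps) = run o c
    where
    run : ∀ o c → T (P ((suc (length B) , o) ∷ replicate c (suc (length B) , false) ++ staircase true B))
    run o zero    = below o B ps
    run o (suc c) = repeat _ o _ (run false c)

  below o []          []       = single o
  below o (zero ∷ B)  (() ∷ _)
  below o (suc c ∷ B) ps       = descend _ o _ (staircase-chain true (suc c) B ps)

staircase-allPos : ∀ o b B → All (1 ≤_) (b ∷ B) → T (allPos (staircase o (b ∷ B)))
staircase-allPos = staircase-chain allPos (λ _ → _) (λ _ _ _ p → p) (λ _ _ _ p → p)

staircase-wellOrdered : ∀ o b B → All (1 ≤_) (b ∷ B) → T (wellOrdered (staircase o (b ∷ B)))
staircase-wellOrdered = staircase-chain wellOrdered (λ _ → _)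
  (λ v _ _ p → from T-∧ (≤⇒≤ᵇ (≤-refl {suc v}) , from T-∧ (from (T-if-else-true (suc v ≡ᵇ suc v)) _ , p)))
  (λ v _ _ p → from T-∧ (≤⇒≤ᵇ (n≤1+n (suc v)) ,
     from T-∧ (from (T-if-else-true (suc v ≡ᵇ suc (suc v))) (⊥-elim ∘ 1+n≢n ∘ sym ∘ ≡ᵇ⇒≡ (suc v) _) , p)))

staircase-gapCond : ∀ o b B → All (1 ≤_) (b ∷ B) → T (gapCond (staircase o (b ∷ B)))
staircase-gapCond = staircase-chain gapCond (λ _ → _)
  (λ v _ _ p → from T-∧ (<⇒<ᵇ (n<1+n (suc v)) , p))
  (λ v _ _ p → from T-∧ (≤⇒≤ᵇ (≤-refl {suc (suc v)}) , p))

staircase-largestIs : ∀ o {b} B → 1 ≤ b → T (largestIs (suc (length B) , o) (staircase o (b ∷ B)))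
staircase-largestIs o B (s≤s _) = from T-∧ (≡⇒≡ᵇ (suc (length B)) _ refl , T-if-self o)

runs-injective : ∀ {v v′} c c′ {B B′} → All (1 ≤_) B → All (1 ≤_) B′ →
                 replicate c (v , false) ++ staircase true B ≡ replicate c′ (v′ , false) ++ staircase true B′ →
                 c ≡ c′ × staircase true B ≡ staircase true B′
runs-injective zero    zero     _           _           eq = refl , eq
runs-injective (suc c) (suc c′) ps          ps′         eq =
  let (c≡c′ , lower) = runs-injective c c′ ps ps′ (∷-injectiveʳ eq) in cong suc c≡c′ , lower
runs-injective zero    (suc c′) []          _           ()
runs-injective zero    (suc c′) (s≤s _ ∷ _) _           ()
runs-injective (suc c) zero     _           []          ()
runs-injective (suc c) zero     _           (s≤s _ ∷ _) ()

staircase-injective : ∀ {o M M′} → All (1 ≤_) M → All (1 ≤_) M′ → staircase o M ≡ staircase o M′ → M ≡ M′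
staircase-injective []          []          _  = refl
staircase-injective []          (s≤s _ ∷ _) ()
staircase-injective (s≤s _ ∷ _) []          ()
staircase-injective {M = suc c ∷ _} {suc c′ ∷ _} (s≤s _ ∷ ps) (s≤s _ ∷ ps′) eq
  with runs-injective c c′ ps ps′ (∷-injectiveʳ eq)
... | refl , lower = cong (suc c ∷_) (staircase-injective ps ps′ lower)

adjacent-parts : ∀ v o w o′ r →
                 T (wellOrdered ((v , o) ∷ (w , o′) ∷ r)) → T (gapCond ((v , o) ∷ (w , o′) ∷ r)) →
                 v ≡ (if o′ then suc w else w) × T (wellOrdered ((w , o′) ∷ r)) × T (gapCond ((w , o′) ∷ r))
adjacent-parts v o w false r wo gap =
  let (w≤v , rest)    = to T-∧ wo
      (_ , wo′)       = to T-∧ rest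
      (v<1+w , gap′)  = to T-∧ gap
  in  ≤-antisym (≤-pred (<ᵇ⇒< v (suc w) v<1+w)) (≤ᵇ⇒≤ w v w≤v) , wo′ , gap′
adjacent-parts v o w true r wo gap =
  let (w≤v , rest)    = to T-∧ wo
      (w≢v , wo′)     = to T-∧ rest
      (v≤1+w , gap′)  = to T-∧ gap
  in  ≤-antisym (≤ᵇ⇒≤ v (suc w) v≤1+w)
                (≤∧≢⇒< (≤ᵇ⇒≤ w v w≤v) (λ w≡v → to (T-if-else-true (w ≡ᵇ v)) w≢v (≡⇒≡ᵇ w v w≡v))) ,
      wo′ , gap′

module _ (k : ℕ) .{{_ : NonZero k}} where

  lastCond-singleton : ∀ v o → T (lastCond k ((v , o) ∷ [])) → v ≡ 1
  lastCond-singleton v o last with k ≡ᵇ 1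
  ... | true  = ≡ᵇ⇒≡ v 1 last
  ... | false = ≡ᵇ⇒≡ v 1 (proj₁ (to T-∧ last))

  staircase-shape : ∀ v o r →
                    T (wellOrdered ((v , o) ∷ r)) → T (gapCond ((v , o) ∷ r)) → T (lastCond k ((v , o) ∷ r)) →
                    Σ ℕ λ b → Σ (List ℕ) λ B →
                    All (1 ≤_) (b ∷ B) × suc (length B) ≡ v × staircase o (b ∷ B) ≡ (v , o) ∷ r
  staircase-shape v o [] _ _ last with refl ← lastCond-singleton v o last =
    1 , [] , s≤s z≤n ∷ [] , refl , refl
  staircase-shape v o ((w , false) ∷ r) wo gap last with adjacent-parts v o w false r wo gap
  ... | refl , wo′ , gap′ with staircase-shape w false r wo′ gap′ last
  ... | zero  , _ , () ∷ _ , _    , _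
  ... | suc b , B , pos    , refl , eq =
    suc (suc b) , B , s≤s z≤n ∷ All.tail pos , refl , cong ((suc (length B) , o) ∷_) eq
  staircase-shape v o ((w , true) ∷ r) wo gap last with adjacent-parts v o w true r wo gap
  ... | refl , wo′ , gap′ with staircase-shape w true r wo′ gap′ last
  ... | b , B , pos , refl , eq =
    1 , b ∷ B , s≤s z≤n ∷ pos , refl , cong ((suc (suc (length B)) , o) ∷_) eq

  fkCond-replicate-++ : ∀ c v xs → fkCond k (replicate c (v , false) ++ xs) ≡ fkCond k xs
  fkCond-replicate-++ zero    v xs = refl
  fkCond-replicate-++ (suc c) v xs = fkCond-replicate-++ c v xs

  fkCond-staircase-true : ∀ M → All (1 ≤_) M → T (fkCond k (staircase true M)) ⇔ All (k ∣_) M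
  fkCond-staircase-true []          _        = mk⇔ (λ _ → []) (λ _ → _)
  fkCond-staircase-true (zero ∷ B)  (() ∷ _)
  fkCond-staircase-true (suc c ∷ B) (_ ∷ ps) = mk⇔ elim intro
    where
    lower = fkCond-staircase-true B ps
    R = replicate c (suc (length B) , false) ++ staircase true B
    lower-skip : fkCond k R ≡ fkCond k (staircase true B)
    lower-skip = fkCond-replicate-++ c _ _
    length-top : suc (length R) ≡ suc c + sum B
    length-top = length-staircase true (suc c ∷ B)
    elim : T (fkCond k (staircase true (suc c ∷ B))) → All (k ∣_) (suc c ∷ B)
    elim fk =
      let (top , rest) = to T-∧ fk
          k∣B          = to lower (subst T lower-skip rest)
          k∣total      = subst (k ∣_) length-top (m%n≡0⇒n∣m _ k (≡ᵇ⇒≡ _ 0 top))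
      in  ∣m+n∣m⇒∣n (subst (k ∣_) (+-comm (suc c) (sum B)) k∣total) (∣-sum k∣B) ∷ k∣B
    intro : All (k ∣_) (suc c ∷ B) → T (fkCond k (staircase true (suc c ∷ B)))
    intro (k∣b ∷ k∣B) =
      from T-∧ (≡⇒≡ᵇ _ 0 (n∣m⇒m%n≡0 _ k (subst (k ∣_) (sym length-top) (∣m∣n⇒∣m+n k∣b (∣-sum k∣B)))) ,
                subst T (sym lower-skip) (from lower k∣B))

  fkCond-staircase : ∀ o b B → All (1 ≤_) (b ∷ B) →
                     T (fkCond k (staircase o (b ∷ B))) ⇔ ((T o → k ∣ b) × All (k ∣_) B)
  fkCond-staircase true b B ps = mk⇔
    (λ fk → let k∣bB = to whole fk in (λ _ → All.head k∣bB) , All.tail k∣bB)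
    (λ (k∣b , k∣B) → from whole (k∣b _ ∷ k∣B))
    where whole = fkCond-staircase-true (b ∷ B) ps
  fkCond-staircase false zero    B (() ∷ _)
  fkCond-staircase false (suc c) B (_ ∷ ps) = mk⇔
    (λ fk → (λ ()) , to lower (subst T (fkCond-replicate-++ c _ _) fk))
    (λ (_ , k∣B) → subst T (sym (fkCond-replicate-++ c _ _)) (from lower k∣B))
    where lower = fkCond-staircase-true B ps

  lastCond-++ : ∀ {p} xs {q ys} → T (lastCond k (q ∷ ys)) → T (lastCond k (p ∷ xs ++ q ∷ ys))
  lastCond-++ []       last = last
  lastCond-++ (x ∷ xs) last = lastCond-++ {x} xs last

  lastCond-block : ∀ o c → (T o → k ∣ suc c) → T (lastCond k ((1 , o) ∷ replicate c (1 , false)))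
  lastCond-block o     (suc c) _   = lastCond-block false c (λ ())
  lastCond-block false zero    _   = from (T-if-else-true (k ≡ᵇ 1)) _
  lastCond-block true  zero    k∣1 = subst (λ m → T (if m ≡ᵇ 1 then true else false)) (sym (∣1⇒≡1 (k∣1 _))) _

  staircase-lastCond : ∀ o b B → All (1 ≤_) (b ∷ B) → (T o → k ∣ b) → All (k ∣_) B →
                       T (lastCond k (staircase o (b ∷ B)))
  staircase-lastCond o zero    B            (() ∷ _)     _   _
  staircase-lastCond o (suc c) []           _            k∣b _ =
    subst (T ∘ lastCond k ∘ ((1 , o) ∷_)) (sym (++-identityʳ (replicate c (1 , false))))
          (lastCond-block o c k∣b)
  staircase-lastCond o (suc c) (zero ∷ B)   (_ ∷ () ∷ _) _   _
  staircase-lastCond o (suc c) (suc c′ ∷ B) (_ ∷ ps)     _   (k∣b′ ∷ k∣B) =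
    lastCond-++ (replicate c _) (staircase-lastCond true (suc c′) B ps (λ _ → k∣b′) k∣B)

  inBF⇔ : ∀ l → T (inBF k l) ⇔
          (1 ≤ length l × T (allPos l) × T (wellOrdered l) × T (fkCond k l) × T (lastCond k l) × T (gapCond l))
  inBF⇔ l = mk⇔
    (λ bf → let (len , bf)   = to (T-∧ {1 ≤ᵇ length l}) bf
                (fk , bf)    = to (T-∧ {isFk k l}) bf
                (last , gap) = to (T-∧ {lastCond k l}) bf
                (ov , fk)    = to (T-∧ {isOverPtn l}) fk
                (pos , wo)   = to (T-∧ {allPos l}) ov
            in  ≤ᵇ⇒≤ 1 _ len , pos , wo , fk , last , gap)
    (λ (len , pos , wo , fk , last , gap) →
       from T-∧ (≤⇒≤ᵇ len , from T-∧ (from T-∧ (from T-∧ (pos , wo) , fk) , from T-∧ (last , gap))))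

  staircase-inBF : ∀ o b B → All (1 ≤_) (b ∷ B) → (T o → k ∣ b) → All (k ∣_) B →
                   T (inBF k (staircase o (b ∷ B)))
  staircase-inBF o zero    B (() ∷ _) _   _
  staircase-inBF o (suc c) B ps       k∣b k∣B = from (inBF⇔ (staircase o (suc c ∷ B)))
    ( s≤s z≤n
    , staircase-allPos o _ B ps
    , staircase-wellOrdered o _ B ps
    , from (fkCond-staircase o _ B ps) (k∣b , k∣B)
    , staircase-lastCond o _ B ps k∣b k∣B
    , staircase-gapCond o _ B ps
    )

  inBF⇒staircase : ∀ o j l → T (inBF k l) → T (largestIs (j , o) l) →
                   Σ ℕ λ b → Σ (List ℕ) λ B →
                   All (1 ≤_) (b ∷ B) × suc (length B) ≡ j × (T o → k ∣ b) × All (k ∣_) B × staircase o (b ∷ B) ≡ l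
  inBF⇒staircase o j ((v , o′) ∷ r) inbf top
    with refl ← ≡ᵇ⇒≡ v j (proj₁ (to (T-∧ {v ≡ᵇ j}) top))
       | refl ← T-if-self⁻ o {o′} (proj₂ (to (T-∧ {v ≡ᵇ j}) top)) =
    let (_ , _ , wo , fk , last , gap)  = to (inBF⇔ ((v , o) ∷ r)) inbf
        (b , B , pos , len , shape)     = staircase-shape v o r wo gap last
        (k∣b , k∣B)                     = to (fkCond-staircase o b B pos) (subst (T ∘ fkCond k) (sym shape) fk)
    in  b , B , pos , len , k∣b , k∣B , shape

  length-staircase-mod : ∀ o b {B} → All (k ∣_) B → length (staircase o (b ∷ B)) % k ≡ b % k
  length-staircase-mod o b {B} k∣B =
    trans (cong (_% k) (trans (length-staircase o (b ∷ B)) (+-comm b (sum B)))) (%-remove-+ˡ b (∣-sum k∣B))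

  isD⇔ : ∀ s n j μ → T (isD k s n j μ) ⇔
         (T (allPosL μ) × T (strictDec μ) × sumL μ ≡ n × length μ ≡ j × T (allCong k s μ))
  isD⇔ s n j μ = mk⇔
    (λ d → let (pos , d)   = to (T-∧ {allPosL μ}) d
               (dec , d)   = to (T-∧ {strictDec μ}) d
               (tot , d)   = to (T-∧ {sumL μ ≡ᵇ n}) d
               (len , mod) = to (T-∧ {length μ ≡ᵇ j}) d
           in  pos , dec , ≡ᵇ⇒≡ _ _ tot , ≡ᵇ⇒≡ _ _ len , mod)
    (λ (pos , dec , tot , len , mod) →
       from T-∧ (pos , from T-∧ (dec , from T-∧ (≡⇒≡ᵇ _ _ tot , from T-∧ (≡⇒≡ᵇ _ _ len , mod)))))

  -- (C , b) are the gaps of μ = scanr _+_ b C; on the overpartition side b is the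
  -- multiplicity of j and reverse C lists those of j-1, …, 1.
  record GapData (s n j : ℕ) (C : List ℕ) (b : ℕ) : Set where
    field
      gaps-positive  : All (1 ≤_) C
      last-positive  : 1 ≤ b
      gaps-divisible : All (k ∣_) C
      last-mod       : b % k ≡ s % k
      count          : suc (length C) ≡ j
      total          : sumL (scanr _+_ b C) ≡ n

  multiplicities-positive : ∀ {s n j C b} → GapData s n j C b → All (1 ≤_) (b ∷ reverse C)
  multiplicities-positive g = GapData.last-positive g ∷ All-reverse (GapData.gaps-positive g)

  scanr-isD⁺ : ∀ {s n j C b} → GapData s n j C b → T (isD k s n j (scanr _+_ b C))
  scanr-isD⁺ {s} {n} {j} {C} {b} g = from (isD⇔ s n j (scanr _+_ b C))
    ( from (allPosL⇔All (scanr _+_ b C)) (All.map (≤-trans last-positive) (scanr-+-≥ b C))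
    , from (strictDec⇔Linked (scanr _+_ b C)) (Linked-scanr-+⁺ gaps-positive)
    , total
    , trans (length-scanr _+_ b C) count
    , from (allCong⇔All k s (scanr _+_ b C)) (scanr-+-mod⁺ gaps-divisible last-mod)
    )
    where open GapData g

  scanr-isD⁻ : ∀ {s n j} C b → T (isD k s n j (scanr _+_ b C)) → GapData s n j C b
  scanr-isD⁻ {s} {n} {j} C b d =
    let (pos , dec , tot , len , mod) = to (isD⇔ s n j (scanr _+_ b C)) d
        mod′ = to (allCong⇔All k s (scanr _+_ b C)) mod
    in  record
      { gaps-positive  = Linked-scanr-+⁻ C (to (strictDec⇔Linked (scanr _+_ b C)) dec)
      ; last-positive  = All-scanr-last _+_ b C (to (allPosL⇔All (scanr _+_ b C)) pos)
      ; gaps-divisible = scanr-+-mod⁻ C mod′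
      ; last-mod       = All-scanr-last _+_ b C mod′
      ; count          = trans (sym (length-scanr _+_ b C)) len
      ; total          = tot
      }

  D-parametrisation : ∀ s n j → 1 ≤ j → Parametrisation (uncurry (GapData s n j)) (isD k s n j)
  D-parametrisation s n j 1≤j = record
    { encode    = λ (C , b) → scanr _+_ b C
    ; sound     = scanr-isD⁺
    ; onto      = isD⇒scanr
    ; injective = λ _ _ eq → let (C≡C′ , b≡b′) = scanr-+-injective _ _ eq in cong₂ _,_ C≡C′ b≡b′
    }
    where
    isD⇒scanr : ∀ {μ} → T (isD k s n j μ) → Σ (List ℕ × ℕ) λ (C , b) → GapData s n j C b × scanr _+_ b C ≡ μ
    isD⇒scanr {[]}    d = let (_ , _ , _ , 0≡j , _) = to (isD⇔ s n j []) d in ⊥-elim (<⇒≢ 1≤j 0≡j)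
    isD⇒scanr {x ∷ r} d =
      let (_ , dec , _)  = to (isD⇔ s n j (x ∷ r)) d
          (C , b , eq)   = Linked⇒∃scanr-+ x r (to (strictDec⇔Linked (x ∷ r)) dec)
      in  (C , b) , scanr-isD⁻ C b (subst (T ∘ isD k s n j) (sym eq) d) , eq

  isBF′⇔ : ∀ n j l → T (isBF′ k n j l) ⇔
           (T (inBF k l) × weight l ≡ n × length l % k ≡ 0 × numOvl l ≡ j × T (largestIs (j , true) l))
  isBF′⇔ n j l = mk⇔
    (λ bf → let (inbf , bf) = to (T-∧ {inBF k l}) bf
                (wt , bf)   = to (T-∧ {weight l ≡ᵇ n}) bf
                (len , bf)  = to (T-∧ {length l % k ≡ᵇ 0}) bf
                (ovl , top) = to (T-∧ {numOvl l ≡ᵇ j}) bf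
            in  inbf , ≡ᵇ⇒≡ _ _ wt , ≡ᵇ⇒≡ _ _ len , ≡ᵇ⇒≡ _ _ ovl , top)
    (λ (inbf , wt , len , ovl , top) →
       from T-∧ (inbf , from T-∧ (≡⇒≡ᵇ _ _ wt , from T-∧ (≡⇒≡ᵇ _ _ len , from T-∧ (≡⇒≡ᵇ _ _ ovl , top)))))

  isBF″⇔ : ∀ s n j l → T (isBF″ k s n j l) ⇔
           (T (inBF k l) × weight l ≡ n × length l % k ≡ s % k × numOvl l ≡ j ∸ 1 × T (largestIs (j , false) l))
  isBF″⇔ s n j l = mk⇔
    (λ bf → let (inbf , bf) = to (T-∧ {inBF k l}) bf
                (wt , bf)   = to (T-∧ {weight l ≡ᵇ n}) bf
                (len , bf)  = to (T-∧ {length l % k ≡ᵇ s % k}) bf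
                (ovl , top) = to (T-∧ {numOvl l ≡ᵇ j ∸ 1}) bf
            in  inbf , ≡ᵇ⇒≡ _ _ wt , ≡ᵇ⇒≡ _ _ len , ≡ᵇ⇒≡ _ _ ovl , top)
    (λ (inbf , wt , len , ovl , top) →
       from T-∧ (inbf , from T-∧ (≡⇒≡ᵇ _ _ wt , from T-∧ (≡⇒≡ᵇ _ _ len , from T-∧ (≡⇒≡ᵇ _ _ ovl , top)))))

  gapData⇒staircase : ∀ {s n j C b} → GapData s n j C b → ∀ o → (T o → k ∣ b) →
                      let l = staircase o (b ∷ reverse C) in
                      T (inBF k l) × weight l ≡ n × length l % k ≡ s % k ×
                      numOvl l ≡ (if o then 1 else 0) + length C × T (largestIs (j , o) l)
  gapData⇒staircase {C = C} {b} g o k∣b =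
      staircase-inBF o b (reverse C) (multiplicities-positive g) k∣b (All-reverse gaps-divisible)
    , trans (weight-staircase-reverse o b C) total
    , trans (length-staircase-mod o b (All-reverse gaps-divisible)) last-mod
    , trans (numOvl-staircase o b (reverse C) (multiplicities-positive g)) (cong (_ +_) (length-reverse C))
    , subst (λ m → T (largestIs (m , o) (staircase o (b ∷ reverse C))))
            (trans (cong suc (length-reverse C)) count) (staircase-largestIs o (reverse C) last-positive)
    where open GapData g

  staircase⇒gapData : ∀ o {s n j l} → T (inBF k l) → T (largestIs (j , o) l) →
                      weight l ≡ n → length l % k ≡ s % k →
                      Σ (List ℕ × ℕ) λ (C , b) → GapData s n j C b × staircase o (b ∷ reverse C) ≡ l
  staircase⇒gapData o {j = j} {l} inbf top wt len =
    let (b , B , pos , count , _ , k∣B , shape) = inBF⇒staircase o j l inbf top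
        shape′ : staircase o (b ∷ reverse (reverse B)) ≡ l
        shape′ = trans (cong (λ M → staircase o (b ∷ M)) (reverse-involutive B)) shape
    in  (reverse B , b) , record
          { gaps-positive  = All-reverse (All.tail pos)
          ; last-positive  = All.head pos
          ; gaps-divisible = All-reverse k∣B
          ; last-mod       = trans (sym (length-staircase-mod o b k∣B))
                                   (trans (cong (λ l → length l % k) shape) len)
          ; count          = trans (cong suc (length-reverse B)) count
          ; total          = trans (sym (weight-staircase-reverse o b (reverse B))) (trans (cong weight shape′) wt)
          } , shape′

  staircase-reverse-injective : ∀ {o s n j C b C′ b′} → GapData s n j C b → GapData s n j C′ b′ →
                                staircase o (b ∷ reverse C) ≡ staircase o (b′ ∷ reverse C′) → (C , b) ≡ (C′ , b′)
  staircase-reverse-injective g g′ eq =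
    let M≡M′               = staircase-injective (multiplicities-positive g) (multiplicities-positive g′) eq
        (b≡b′ , rev≡rev′) = ∷-injective M≡M′
    in  cong₂ _,_ (reverse-injective rev≡rev′) b≡b′

  BF′-parametrisation : ∀ n j → Parametrisation (uncurry (GapData k n j)) (isBF′ k n j)
  BF′-parametrisation n j = record
    { encode    = λ (C , b) → staircase true (b ∷ reverse C)
    ; sound     = λ {(C , b)} g →
        let (inbf , wt , len , ovl , top) = gapData⇒staircase g true (λ _ → k∣b g)
        in  from (isBF′⇔ n j (staircase true (b ∷ reverse C)))
                 (inbf , wt , trans len (n%n≡0 k) , trans ovl (GapData.count g) , top)
    ; onto      = λ {l} bf →
        let (inbf , wt , len , _ , top) = to (isBF′⇔ n j l) bf
        in  staircase⇒gapData true inbf top wt (trans len (sym (n%n≡0 k)))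
    ; injective = staircase-reverse-injective
    }
    where
    k∣b : ∀ {C b} → GapData k n j C b → k ∣ b
    k∣b g = m%n≡0⇒n∣m _ k (trans (GapData.last-mod g) (n%n≡0 k))

  BF″-parametrisation : ∀ s n j → Parametrisation (uncurry (GapData s n j)) (isBF″ k s n j)
  BF″-parametrisation s n j = record
    { encode    = λ (C , b) → staircase false (b ∷ reverse C)
    ; sound     = λ {(C , b)} g →
        let (inbf , wt , len , ovl , top) = gapData⇒staircase g false (λ ())
        in  from (isBF″⇔ s n j (staircase false (b ∷ reverse C)))
                 (inbf , wt , len , trans ovl (cong (_∸ 1) (GapData.count g)) , top)
    ; onto      = λ {l} bf →
        let (inbf , wt , len , _ , top) = to (isBF″⇔ s n j l) bf
        in  staircase⇒gapData false inbf top wt len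
    ; injective = staircase-reverse-injective
    }

proposition3p13 : (k : ℕ) → .{{_ : NonZero k}} → (n j : ℕ) → 1 ≤ n → 1 ≤ j →
    (BF′ k n j ↔ D k k n j)
    × ((s : ℕ) → 1 ≤ s → s ≤ k → BF″ k s n j ↔ D k s n j)
proposition3p13 k n j _ 1≤j =
    parametrisations⇒↔ (BF′-parametrisation k n j) (D-parametrisation k k n j 1≤j)
  , λ s _ _ → parametrisations⇒↔ (BF″-parametrisation k s n j) (D-parametrisation k s n j 1≤j)
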